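{- Let $r\geq 1$ and let $n_1,\ldots,n_r\geq 2$ be integers, with $C_{n_k}$ the cycle on $n_k$ vertices. Then $$\mathrm{src}(C_{n_1}\square\cdots\square C_{n_r})\leq\left\lceil\frac{n_1+\cdots+n_r}{2}\right\rceil.$$
   Context: All graphs are finite, simple and connected; $C_n$ is the cycle on $n$ vertices, and $C_2$ denotes the graph with two vertices joined by a single edge. An edge-coloring $\zeta:E(\Gamma)\to\{1,\ldots,k\}$ (adjacent edges may share colors) is a strong rainbow $k$-coloring if every two distinct vertices $u,v$ are joined by a path of length $d(u,v)$ (the graph distance) whose edges have pairwise distinct colors. The strong rainbow connection number $\mathrm{src}(\Gamma)$ is the minimum $k$ for which a strong rainbow $k$-coloring of $\Gamma$ exists. The Cartesian product $\Gamma\square\Lambda$ has vertex set $V(\Gamma)\times V(\Lambda)$, with $(\gamma,\lambda)$ adjacent to $(\gamma',\lambda')$ iff either $\lambda=\lambda'$ and $\gamma\gamma'\in E(\Gamma)$, or $\gamma=\gamma'$ and $\lambda\lambda'\in E(\Lambda)$; it is associative and commutative up to isomorphism. -}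

module Defs where

open import Level using (0ℓ)
open import Data.Nat using (ℕ; zero; suc; _+_; _≤_; _%_)
open import Data.Fin using (Fin; toℕ)
open import Data.Product using (_×_; _,_; Σ; ∃)
open import Data.Sum using (_⊎_)
open import Data.List using (List; []; _∷_)
open import Data.List.Relation.Unary.Unique.Propositional using (Unique)
open import Data.Vec using (Vec; []; _∷_)
open import Relation.Binary.PropositionalEquality using (_≡_)

record Graph : Set₁ where
  field
    V   : Set
    Adj : V → V → Set
open Graph public

-- The cycle C_n on vertex set Fin n: i ~ j iff j ≡ i+1 (mod n) or i ≡ j+1 (mod n).
-- For n = 2 this is the single edge 0 — 1 (C_2 as in the paper).
Cycle : ℕ → Graph
Cycle zero    = record { V = Fin zero ; Adj = λ _ _ → Data.Empty.⊥ }
  where import Data.Empty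
Cycle (suc m) = record
  { V   = Fin (suc m)
  ; Adj = λ i j → (toℕ j ≡ (suc (toℕ i)) % suc m) ⊎ (toℕ i ≡ (suc (toℕ j)) % suc m)
  }

_□_ : Graph → Graph → Graph
Γ □ Λ = record
  { V   = V Γ × V Λ
  ; Adj = λ { (g , l) (g' , l') → (l ≡ l' × Adj Γ g g') ⊎ (g ≡ g' × Adj Λ l l') }
  }

CycleProduct : ∀ {r} → Vec ℕ (suc r) → Graph
CycleProduct (n ∷ [])       = Cycle n
CycleProduct (n ∷ (m ∷ ns)) = Cycle n □ CycleProduct (m ∷ ns)

data Walk (G : Graph) : V G → V G → Set where
  []  : ∀ {u} → Walk G u u
  _∷_ : ∀ {u w v} → Adj G u w → Walk G w v → Walk G u v

walkLength : ∀ {G u v} → Walk G u v → ℕ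
walkLength []      = 0
walkLength (_ ∷ p) = suc (walkLength p)

-- An edge-colouring with k colours, given as a symmetric colour assignment to
-- pairs of vertices (only its values on edges are used); the colour of edge uv
-- is ζ u v = ζ v u.
record EdgeColoring (G : Graph) (k : ℕ) : Set where
  field
    colour    : V G → V G → Fin k
    symmetric : ∀ u v → colour u v ≡ colour v u
open EdgeColoring public

walkColours : ∀ {G k u v} → EdgeColoring G k → Walk G u v → List (Fin k)
walkColours ζ ([] )               = []
walkColours ζ (_∷_ {u} {w} e p)   = colour ζ u w ∷ walkColours ζ p

IsGeodesic : ∀ {G u v} → Walk G u v → Set
IsGeodesic {G} {u} {v} p = ∀ (q : Walk G u v) → walkLength p ≤ walkLength q

IsStrongRainbow : ∀ {G k} → EdgeColoring G k → Set
IsStrongRainbow {G} ζ =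
  ∀ (u v : V G) → (u ≡ v → Data.Empty.⊥) →
    Σ (Walk G u v) λ p → IsGeodesic p × Unique (walkColours ζ p)
  where import Data.Empty

-- src(G) ≤ m  ⇔  G admits a strong rainbow k-colouring for some k ≤ m
-- (src is the minimum such k).
src≤ : Graph → ℕ → Set
src≤ G m = ∃ λ k → k ≤ m × Σ (EdgeColoring G k) IsStrongRainbow

module Submission where

-- The proof manipulates rainbow systems: two edge-colourings of a graph
-- together with, for every pair of vertices, one path whose length is
-- certified minimal (by a distance function dropping by at most one along an
-- edge) and which is rainbow under both colourings.  A colour is free if each
-- such path avoids it under one of the two colourings.
-- Finally an induction over the factors provides ⌈s/2⌉ colours for the weight
-- s = Σ nᵢ, with a free colour when s is odd; two odd weights meet by sharing.

open import Defs
open import Data.Bool using (Bool; true; false)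
open import Data.Bool.Properties using (¬-not) renaming (_≟_ to _≟ᵇ_)
open import Data.Empty using (⊥; ⊥-elim)
open import Data.Fin as Fin using (Fin; zero; suc; toℕ; fromℕ; fromℕ<; _↑ˡ_; _↑ʳ_; splitAt)
open import Data.Fin.Properties using (↑ˡ-injective; ↑ʳ-injective; splitAt-↑ˡ; splitAt-↑ʳ; toℕ<n; toℕ-fromℕ<; toℕ-fromℕ; toℕ-injective; fromℕ<-injective)
  renaming (suc-injective to fsuc-injective)
open import Data.List using (List; []; _∷_; _++_; map; reverse; applyUpTo)
open import Data.List.Properties using (unfold-reverse)
open import Data.List.Membership.Propositional using (_∈_; _∉_)
open import Data.List.Membership.Propositional.Properties using (∈-map⁻; ∈-++⁻; ∈-applyUpTo⁻)
import Data.List.Membership.DecPropositional as DecMembership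
open import Data.List.Relation.Binary.Permutation.Propositional using (_↭_; ↭⇒↭ₛ; ↭-reflexive; ↭-sym; ↭-trans)
open import Data.List.Relation.Binary.Permutation.Propositional.Properties using (↭-reverse; Any-resp-↭)
import Data.List.Relation.Binary.Permutation.Setoid.Properties as PermutationSetoid
open import Data.List.Relation.Unary.Unique.Propositional using (Unique)
open import Data.List.Relation.Unary.Unique.Propositional.Properties using (map⁺; ++⁺; applyUpTo⁺₁)
open import Data.Nat using (ℕ; zero; suc; _+_; _*_; _∸_; _≤_; _<_; z≤n; s≤s; s≤s⁻¹; _%_; _/_; _⊓_; _≟_; _≤?_; _<?_; NonZero; >-nonZero; ⌈_/2⌉)
open import Data.Nat.Properties
open import Data.Nat.DivMod using (_mod_; m≡m%n+[m/n]*n; m<n⇒m%n≡m; m%n<n; n%n≡0; m%n%n≡m%n; %-distribˡ-+; %-remove-+ˡ; m≤n⇒[n∸m]%m≡n%m; m∣n⇒o%n%m≡o%m)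
open import Data.Nat.Divisibility using (_∣_; divides; ∣-refl; ∣⇒≤)
open import Data.Nat.Tactic.RingSolver using (solve-∀)
open import Data.Product using (Σ; ∃; _×_; _,_; proj₁; proj₂)
open import Data.Product.Properties using (≡-dec)
open import Data.Sum using (_⊎_; inj₁; inj₂; [_,_]; swap)
open import Data.Vec using (Vec; []; _∷_; sum)
open import Data.Vec.Relation.Unary.All using (All; []; _∷_)
open import Relation.Binary.Definitions using (DecidableEquality; tri<; tri≈; tri>)
open import Relation.Binary.PropositionalEquality using (_≡_; _≢_; ≢-sym; refl; sym; trans; cong; cong₂; subst; module ≡-Reasoning; setoid)
open import Relation.Nullary using (¬_; yes; no; does)
open import Relation.Nullary.Decidable using (dec-true; dec-false)

private
  variable
    A B C : Set

opposite : ∀ {x y} → x ≡ true → y ≡ false → x ≢ y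
opposite refl refl ()

unique-↭ : {xs ys : List A} → xs ↭ ys → Unique xs → Unique ys
unique-↭ {A} p = PermutationSetoid.Unique-resp-↭ (setoid A) (↭⇒↭ₛ p)

unique-map-++ : {α : A → C} {β : B → C} {xs : List A} {ys : List B} →
  (∀ {x y} → α x ≡ α y → x ≡ y) → (∀ {x y} → β x ≡ β y → x ≡ y) →
  (∀ {x y} → x ∈ xs → y ∈ ys → α x ≢ β y) →
  Unique xs → Unique ys → Unique (map α xs ++ map β ys)
unique-map-++ {α = α} {β} {xs} {ys} α-inj β-inj apart uxs uys =
  ++⁺ (map⁺ α-inj uxs) (map⁺ β-inj uys) disjoint
  where
  disjoint : ∀ {z} → ¬ (z ∈ map α xs × z ∈ map β ys)
  disjoint (zα , zβ) with ∈-map⁻ α zα | ∈-map⁻ β zβ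
  ... | x , x∈xs , refl | y , y∈ys , αx≡βy = apart x∈xs y∈ys αx≡βy

module _ {α : A → C} {β : B → C} (apart : ∀ x y → α x ≢ β y) where

  ∈-map-++⁻ˡ : {xs : List A} {ys : List B} {x : A} → (∀ {x y} → α x ≡ α y → x ≡ y) →
    α x ∈ map α xs ++ map β ys → x ∈ xs
  ∈-map-++⁻ˡ {xs} α-inj mem with ∈-++⁻ (map α xs) mem
  ... | inj₁ inα with ∈-map⁻ α inα
  ...   | _ , x'∈xs , αx≡αx' = subst (_∈ xs) (sym (α-inj αx≡αx')) x'∈xs
  ∈-map-++⁻ˡ {xs} α-inj mem | inj₂ inβ with ∈-map⁻ β inβ
  ...   | y , _ , αx≡βy = ⊥-elim (apart _ y αx≡βy)

  ∈-map-++⁻ʳ : {xs : List A} {ys : List B} {y : B} → (∀ {x y} → β x ≡ β y → x ≡ y) →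
    β y ∈ map α xs ++ map β ys → y ∈ ys
  ∈-map-++⁻ʳ {xs} β-inj mem with ∈-++⁻ (map α xs) mem
  ... | inj₂ inβ with ∈-map⁻ β inβ
  ...   | _ , y'∈ys , βy≡βy' = subst (_∈ _) (sym (β-inj βy≡βy')) y'∈ys
  ∈-map-++⁻ʳ {xs} β-inj mem | inj₁ inα with ∈-map⁻ α inα
  ...   | x , _ , βy≡αx = ⊥-elim (apart x _ (sym βy≡αx))

↑ˡ≢↑ʳ : ∀ {k₁ k₂} (i : Fin k₁) (j : Fin k₂) → i ↑ˡ k₂ ≢ k₁ ↑ʳ j
↑ˡ≢↑ʳ {k₁} {k₂} i j eq with trans (sym (splitAt-↑ˡ k₁ i k₂)) (trans (cong (splitAt k₁) eq) (splitAt-↑ʳ k₁ k₂ j))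
... | ()

applyUpTo-cong : ∀ {A : Set} {f g : ℕ → A} → (∀ {s} → f s ≡ g s) → ∀ t → applyUpTo f t ≡ applyUpTo g t
applyUpTo-cong f≗g zero = refl
applyUpTo-cong f≗g (suc t) = cong₂ _∷_ f≗g (applyUpTo-cong f≗g t)

%-≡⇒∣∸ : ∀ {y z} d .{{_ : NonZero d}} → y % d ≡ z % d → y ≤ z → d ∣ z ∸ y
%-≡⇒∣∸ {y} {z} d eq y≤z = divides (z / d ∸ y / d) (begin
  z ∸ y                                     ≡⟨ cong₂ _∸_ (m≡m%n+[m/n]*n z d) (m≡m%n+[m/n]*n y d) ⟩
  (z % d + z / d * d) ∸ (y % d + y / d * d) ≡⟨ cong (λ r → (z % d + z / d * d) ∸ (r + y / d * d)) eq ⟩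
  (z % d + z / d * d) ∸ (z % d + y / d * d) ≡⟨ [m+n]∸[m+o]≡n∸o (z % d) _ _ ⟩
  z / d * d ∸ y / d * d                     ≡⟨ *-distribʳ-∸ d (z / d) (y / d) ⟨
  (z / d ∸ y / d) * d                       ∎)
  where open ≡-Reasoning

%-below-double : ∀ z c .{{_ : NonZero c}} → z < c + c → z % c ≡ z ⊎ z % c + c ≡ z
%-below-double z c z<2c with z <? c
... | yes z<c = inj₁ (m<n⇒m%n≡m z<c)
... | no z≮c = inj₂ (begin
  z % c + c       ≡⟨ cong (_+ c) (m≤n⇒[n∸m]%m≡n%m c≤z) ⟨
  (z ∸ c) % c + c ≡⟨ cong (_+ c) (m<n⇒m%n≡m (m<n+o⇒m∸n<o z c z<2c)) ⟩
  z ∸ c + c       ≡⟨ m∸n+n≡m c≤z ⟩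
  z               ∎)
  where
  open ≡-Reasoning
  c≤z = ≮⇒≥ z≮c

∸-suc-split : ∀ {x y} → x < y → y ∸ x ≡ suc (y ∸ suc x)
∸-suc-split {zero}  {suc y} _ = refl
∸-suc-split {suc x} {suc y} (s≤s x<y) = ∸-suc-split x<y

halve : ∀ {t a} → t + t ≤ suc (a + a) → t ≤ a
halve {t} {a} tt with t ≤? a
... | yes t≤a = t≤a
... | no t≰a = ⊥-elim (1+n≰n (subst (_≤ suc (a + a)) (cong suc (+-suc a a)) (≤-trans (+-mono-≤ a<t a<t) tt)))
  where a<t = ≰⇒> t≰a

module _ {G : Graph} where

  _++ʷ_ : ∀ {u w v} → Walk G u w → Walk G w v → Walk G u v
  [] ++ʷ q = q
  (e ∷ p) ++ʷ q = e ∷ (p ++ʷ q)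

  length-++ʷ : ∀ {u w v} (p : Walk G u w) (q : Walk G w v) →
    walkLength (p ++ʷ q) ≡ walkLength p + walkLength q
  length-++ʷ [] q = refl
  length-++ʷ (e ∷ p) q = cong suc (length-++ʷ p q)

  colours-++ʷ : ∀ {k} (ζ : EdgeColoring G k) {u w v} (p : Walk G u w) (q : Walk G w v) →
    walkColours ζ (p ++ʷ q) ≡ walkColours ζ p ++ walkColours ζ q
  colours-++ʷ ζ [] q = refl
  colours-++ʷ ζ (e ∷ p) q = cong (_ ∷_) (colours-++ʷ ζ p q)

  length-subst : ∀ {u v v'} (eq : v ≡ v') (p : Walk G u v) →
    walkLength (subst (Walk G u) eq p) ≡ walkLength p
  length-subst refl p = refl

  colours-subst : ∀ {k} (ζ : EdgeColoring G k) {u v v'} (eq : v ≡ v') (p : Walk G u v) →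
    walkColours ζ (subst (Walk G u) eq p) ≡ walkColours ζ p
  colours-subst ζ refl p = refl

  module Reversal (adj-sym : ∀ {u v} → Adj G u v → Adj G v u) where

    reverseʷ : ∀ {u v} → Walk G u v → Walk G v u
    reverseʷ [] = []
    reverseʷ (e ∷ p) = reverseʷ p ++ʷ (adj-sym e ∷ [])

    length-reverseʷ : ∀ {u v} (p : Walk G u v) → walkLength (reverseʷ p) ≡ walkLength p
    length-reverseʷ [] = refl
    length-reverseʷ (e ∷ p) = begin
      walkLength (reverseʷ p ++ʷ (adj-sym e ∷ [])) ≡⟨ length-++ʷ (reverseʷ p) _ ⟩
      walkLength (reverseʷ p) + 1                   ≡⟨ +-comm _ 1 ⟩
      suc (walkLength (reverseʷ p))                 ≡⟨ cong suc (length-reverseʷ p) ⟩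
      suc (walkLength p)                            ∎
      where open ≡-Reasoning

    colours-reverseʷ : ∀ {k} (ζ : EdgeColoring G k) {u v} (p : Walk G u v) →
      walkColours ζ (reverseʷ p) ≡ reverse (walkColours ζ p)
    colours-reverseʷ ζ [] = refl
    colours-reverseʷ ζ (_∷_ {u} {w} e p) = begin
      walkColours ζ (reverseʷ p ++ʷ (adj-sym e ∷ []))      ≡⟨ colours-++ʷ ζ (reverseʷ p) _ ⟩
      walkColours ζ (reverseʷ p) ++ (colour ζ w u ∷ [])    ≡⟨ cong₂ _++_ (colours-reverseʷ ζ p) (cong (_∷ []) (symmetric ζ w u)) ⟩
      reverse (walkColours ζ p) ++ (colour ζ u w ∷ [])     ≡⟨ unfold-reverse _ (walkColours ζ p) ⟨
      reverse (colour ζ u w ∷ walkColours ζ p)             ∎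
      where open ≡-Reasoning

record Distance (G : Graph) : Set where
  field
    decEq     : DecidableEquality (V G)
    loopless  : ∀ {u} → ¬ Adj G u u
    dist      : V G → V G → ℕ
    dist-refl : ∀ v → dist v v ≡ 0
    dist-step : ∀ {u w} v → Adj G u w → dist u v ≤ suc (dist w v)

  dist≤length : ∀ {u v} (p : Walk G u v) → dist u v ≤ walkLength p
  dist≤length {u} [] = ≤-reflexive (dist-refl u)
  dist≤length {u} {v} (e ∷ p) = ≤-trans (dist-step v e) (s≤s (dist≤length p))

-- The second colouring only serves to make colours "free" (see IsFree).
record RainbowSystem (G : Graph) (k : ℕ) : Set where
  field
    distance     : Distance G
    colouring    : Bool → EdgeColoring G k
    path         : ∀ u v → Walk G u v
  open Distance distance public
  field
    path-length  : ∀ u v → walkLength (path u v) ≡ dist u v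
    path-rainbow : ∀ b u v → Unique (walkColours (colouring b) (path u v))

  pathColours : Bool → V G → V G → List (Fin k)
  pathColours b u v = walkColours (colouring b) (path u v)

  path-geodesic : ∀ u v → IsGeodesic (path u v)
  path-geodesic u v q = subst (_≤ walkLength q) (sym (path-length u v)) (dist≤length q)

open RainbowSystem

strongRainbow : ∀ {G k} → RainbowSystem G k → Σ (EdgeColoring G k) IsStrongRainbow
strongRainbow R = colouring R true , λ u v _ →
  path R u v , path-geodesic R u v , path-rainbow R true u v

-- A colour S is free when every canonical path avoids S under at least one
-- of the two colourings; free colours of two factors can then be shared.
IsFree : ∀ {G k} → RainbowSystem G k → Fin k → Set
IsFree R S = ∀ u v → Σ Bool λ b → S ∉ pathColours R b u v

module _ {G H : Graph} where

  liftG : ∀ h {g g'} → Walk G g g' → Walk (G □ H) (g , h) (g' , h)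
  liftG h [] = []
  liftG h (e ∷ p) = inj₁ (refl , e) ∷ liftG h p

  liftH : ∀ g {h h'} → Walk H h h' → Walk (G □ H) (g , h) (g , h')
  liftH g [] = []
  liftH g (e ∷ q) = inj₂ (refl , e) ∷ liftH g q

  length-liftG : ∀ h {g g'} (p : Walk G g g') → walkLength (liftG h p) ≡ walkLength p
  length-liftG h [] = refl
  length-liftG h (e ∷ p) = cong suc (length-liftG h p)

  length-liftH : ∀ g {h h'} (q : Walk H h h') → walkLength (liftH g q) ≡ walkLength q
  length-liftH g [] = refl
  length-liftH g (e ∷ q) = cong suc (length-liftH g q)

  length-GH : ∀ {g g' h h'} (p : Walk G g g') (q : Walk H h h') →
    walkLength (liftG h p ++ʷ liftH g' q) ≡ walkLength p + walkLength q
  length-GH {g' = g'} {h} p q = trans (length-++ʷ (liftG h p) (liftH g' q))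
    (cong₂ _+_ (length-liftG h p) (length-liftH g' q))

  length-HG : ∀ {g g' h h'} (p : Walk G g g') (q : Walk H h h') →
    walkLength (liftH g q ++ʷ liftG h' p) ≡ walkLength p + walkLength q
  length-HG {g = g} {h' = h'} p q = trans (length-++ʷ (liftH g q) (liftG h' p))
    (trans (cong₂ _+_ (length-liftH g q) (length-liftG h' p)) (+-comm (walkLength q) _))

productDistance : ∀ {G H} → Distance G → Distance H → Distance (G □ H)
productDistance {G} {H} dG dH = record
  { decEq     = ≡-dec (decEq dG) (decEq dH)
  ; loopless  = loopless⊗
  ; dist      = dist⊗
  ; dist-refl = λ { (g , h) → cong₂ _+_ (dist-refl dG g) (dist-refl dH h) }
  ; dist-step = step⊗
  }
  where
  open Distance
  loopless⊗ : ∀ {u} → ¬ Adj (G □ H) u u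
  loopless⊗ (inj₁ (_ , e)) = loopless dG e
  loopless⊗ (inj₂ (_ , e)) = loopless dH e

  dist⊗ : V (G □ H) → V (G □ H) → ℕ
  dist⊗ (g , h) (g' , h') = dist dG g g' + dist dH h h'

  step⊗ : ∀ {u w} v → Adj (G □ H) u w → dist⊗ u v ≤ suc (dist⊗ w v)
  step⊗ {g , h} (g'' , h'') (inj₁ (refl , e)) = +-monoˡ-≤ (dist dH h h'') (dist-step dG g'' e)
  step⊗ {g , h} (g'' , h'') (inj₂ (refl , e)) =
    subst (dist dG g g'' + dist dH h h'' ≤_) (+-suc _ _) (+-monoʳ-≤ (dist dG g g'') (dist-step dH h'' e))

module ProductColouring {G H : Graph} {k₁ k₂ k : ℕ} (dG : Distance G)
  (α : Fin k₁ → Fin k) (β : Fin k₂ → Fin k)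
  (ζ : EdgeColoring G k₁) (ξ : V G → EdgeColoring H k₂) where

  open Distance dG using () renaming (decEq to _≟ᴳ_; loopless to looplessᴳ)

  colour⊗ : V (G □ H) → V (G □ H) → Fin k
  colour⊗ (g , h) (g' , h') with g ≟ᴳ g'
  ... | yes _ = β (colour (ξ g) h h')
  ... | no _  = α (colour ζ g g')

  symmetric⊗ : ∀ u v → colour⊗ u v ≡ colour⊗ v u
  symmetric⊗ (g , h) (g' , h') with g ≟ᴳ g' | g' ≟ᴳ g
  ... | yes refl | yes _ = cong β (symmetric (ξ g) h h')
  ... | yes g≡g' | no g'≢g = ⊥-elim (g'≢g (sym g≡g'))
  ... | no g≢g'  | yes g'≡g = ⊥-elim (g≢g' (sym g'≡g))
  ... | no _     | no _ = cong α (symmetric ζ g g')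

  colouring⊗ : EdgeColoring (G □ H) k
  colouring⊗ = record { colour = colour⊗ ; symmetric = symmetric⊗ }

  colours-liftG : ∀ h {g g'} (p : Walk G g g') →
    walkColours colouring⊗ (liftG h p) ≡ map α (walkColours ζ p)
  colours-liftG h [] = refl
  colours-liftG h (_∷_ {g} {g'} e p) with g ≟ᴳ g'
  ... | yes refl = ⊥-elim (looplessᴳ e)
  ... | no _ = cong (_ ∷_) (colours-liftG h p)

  colours-liftH : ∀ g {h h'} (q : Walk H h h') →
    walkColours colouring⊗ (liftH g q) ≡ map β (walkColours (ξ g) q)
  colours-liftH g [] = refl
  colours-liftH g (e ∷ q) with g ≟ᴳ g
  ... | yes refl = cong (_ ∷_) (colours-liftH g q)
  ... | no g≢g = ⊥-elim (g≢g refl)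

  colours-GH : ∀ {g g' h h'} (p : Walk G g g') (q : Walk H h h') →
    walkColours colouring⊗ (liftG h p ++ʷ liftH g' q) ≡ map α (walkColours ζ p) ++ map β (walkColours (ξ g') q)
  colours-GH {g' = g'} {h} p q = trans (colours-++ʷ colouring⊗ (liftG h p) (liftH g' q))
    (cong₂ _++_ (colours-liftG h p) (colours-liftH g' q))

  colours-HG : ∀ {g g' h h'} (p : Walk G g g') (q : Walk H h h') →
    walkColours colouring⊗ (liftH g q ++ʷ liftG h' p) ≡ map β (walkColours (ξ g) q) ++ map α (walkColours ζ p)
  colours-HG {g = g} {h' = h'} p q = trans (colours-++ʷ colouring⊗ (liftH g q) (liftG h' p))
    (cong₂ _++_ (colours-liftH g q) (colours-liftG h' p))

module Product {G H : Graph} {k₁ k₂ : ℕ} (R₁ : RainbowSystem G k₁) (R₂ : RainbowSystem H k₂) where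

  private
    module PC b = ProductColouring (distance R₁) (_↑ˡ k₂) (k₁ ↑ʳ_) (colouring R₁ b) (λ _ → colouring R₂ b)

  path⊗ : ∀ u v → Walk (G □ H) u v
  path⊗ (g , h) (g' , h') = liftG h (path R₁ g g') ++ʷ liftH g' (path R₂ h h')

  colours⊗ : ∀ b g g' h h' → walkColours (PC.colouring⊗ b) (path⊗ (g , h) (g' , h')) ≡
    map (_↑ˡ k₂) (pathColours R₁ b g g') ++ map (k₁ ↑ʳ_) (pathColours R₂ b h h')
  colours⊗ b g g' h h' = PC.colours-GH b (path R₁ g g') (path R₂ h h')

  product : RainbowSystem (G □ H) (k₁ + k₂)
  product = record
    { distance     = productDistance (distance R₁) (distance R₂)
    ; colouring    = PC.colouring⊗
    ; path         = path⊗
    ; path-length  = λ { (g , h) (g' , h') → trans (length-GH (path R₁ g g') (path R₂ h h'))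
                           (cong₂ _+_ (path-length R₁ g g') (path-length R₂ h h')) }
    ; path-rainbow = λ { b (g , h) (g' , h') → subst Unique (sym (colours⊗ b g g' h h'))
                           (unique-map-++ (↑ˡ-injective k₂ _ _) (↑ʳ-injective k₁ _ _)
                              (λ {x} {y} _ _ → ↑ˡ≢↑ʳ x y) (path-rainbow R₁ b g g') (path-rainbow R₂ b h h')) }
    }

  free-left : ∀ S → IsFree R₁ S → IsFree product (S ↑ˡ k₂)
  free-left S free (g , h) (g' , h') with free g g'
  ... | b , S∉ = b , λ S∈ →
    S∉ (∈-map-++⁻ˡ ↑ˡ≢↑ʳ (↑ˡ-injective k₂ _ _) (subst (_ ∈_) (colours⊗ b g g' h h') S∈))

  free-right : ∀ S → IsFree R₂ S → IsFree product (k₁ ↑ʳ S)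
  free-right S free (g , h) (g' , h') with free h h'
  ... | b , S∉ = b , λ S∈ →
    S∉ (∈-map-++⁻ʳ ↑ˡ≢↑ʳ (↑ʳ-injective k₁ _ _) (subst (_ ∈_) (colours⊗ b g g' h h') S∈))

mergeLast : ∀ {k} a → Fin k → Fin (suc a) → Fin (a + k)
mergeLast zero    S _       = S
mergeLast (suc a) S zero    = zero
mergeLast (suc a) S (suc c) = suc (mergeLast a S c)

mergeLast-injective : ∀ {k} a (S : Fin k) {c c'} → mergeLast a S c ≡ mergeLast a S c' → c ≡ c'
mergeLast-injective zero    S {zero} {zero} _ = refl
mergeLast-injective (suc a) S {zero} {zero} _ = refl
mergeLast-injective (suc a) S {suc c} {suc c'} eq = cong suc (mergeLast-injective a S (fsuc-injective eq))

mergeLast-meets-↑ʳ : ∀ {k} a (S : Fin k) c y → mergeLast a S c ≡ a ↑ʳ y → c ≡ fromℕ a × y ≡ S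
mergeLast-meets-↑ʳ zero    S zero    y eq = refl , sym eq
mergeLast-meets-↑ʳ (suc a) S (suc c) y eq with mergeLast-meets-↑ʳ a S c y (fsuc-injective eq)
... | refl , y≡S = refl , y≡S

Separates : ∀ {G a} → RainbowSystem G (suc a) → (V G → Bool) → Set
Separates {a = a} R side = ∀ x y → fromℕ a ∈ pathColours R true x y → side x ≢ side y

-- The
-- last G-colour is identified with S, and the fibre over g is coloured by the
-- H-colouring selected by side g; a clash on a staircase path is avoided by
-- choosing which factor to traverse first.
module Shared {G H : Graph} {a k₂ : ℕ}
  (R₁ : RainbowSystem G (suc a)) (side : V G → Bool) (separates : Separates R₁ side)
  (R₂ : RainbowSystem H k₂) (S : Fin k₂) (free : IsFree R₂ S) where

  open ProductColouring (distance R₁) (mergeLast a S) (a ↑ʳ_) (colouring R₁ true) (λ g → colouring R₂ (side g))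
  open DecMembership (Fin._≟_ {n = suc a}) using (_∈?_)

  -- Which staircase is rainbow: G first (the H-part lies over g'), or H first
  -- (the H-part lies over g).
  data Route (g g' : V G) (h h' : V H) : Set where
    G-first : fromℕ a ∉ pathColours R₁ true g g' ⊎ S ∉ pathColours R₂ (side g') h h' → Route g g' h h'
    H-first : S ∉ pathColours R₂ (side g) h h' → Route g g' h h'

  -- If the G-path uses the shared colour, its ends lie on different sides, so
  -- the colouring avoiding S on the H-path is that of the fibre over g or g'.
  route : ∀ g g' h h' → Route g g' h h'
  route g g' h h' with fromℕ a ∈? pathColours R₁ true g g'
  ... | no last∉ = G-first (inj₁ last∉)
  ... | yes last∈ with free h h'
  ...   | b , S∉ with b ≟ᵇ side g'
  ...     | yes refl = G-first (inj₂ S∉)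
  ...     | no b≢side = H-first (subst (λ b → S ∉ pathColours R₂ b h h') b≡side S∉)
    where
    b≡side : b ≡ side g
    b≡side = trans (¬-not b≢side) (sym (¬-not (separates g g' last∈)))

  path⊗ : ∀ u v → Walk (G □ H) u v
  path⊗ (g , h) (g' , h') with route g g' h h'
  ... | G-first _ = liftG h (path R₁ g g') ++ʷ liftH g' (path R₂ h h')
  ... | H-first _ = liftH g (path R₂ h h') ++ʷ liftG h' (path R₁ g g')

  length⊗ : ∀ g g' h h' → walkLength (path⊗ (g , h) (g' , h')) ≡ dist R₁ g g' + dist R₂ h h'
  length⊗ g g' h h' with route g g' h h'
  ... | G-first _ = trans (length-GH (path R₁ g g') (path R₂ h h')) (cong₂ _+_ (path-length R₁ g g') (path-length R₂ h h'))
  ... | H-first _ = trans (length-HG (path R₁ g g') (path R₂ h h')) (cong₂ _+_ (path-length R₁ g g') (path-length R₂ h h'))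

  clash : ∀ {c y} → mergeLast a S c ≡ a ↑ʳ y → c ≡ fromℕ a × y ≡ S
  clash = mergeLast-meets-↑ʳ a S _ _

  rainbow⊗ : ∀ g g' h h' → Unique (walkColours colouring⊗ (path⊗ (g , h) (g' , h')))
  rainbow⊗ g g' h h' with route g g' h h'
  ... | G-first avoid = subst Unique (sym (colours-GH (path R₁ g g') (path R₂ h h')))
        (unique-map-++ (mergeLast-injective a S) (↑ʳ-injective a _ _) apart
           (path-rainbow R₁ true g g') (path-rainbow R₂ (side g') h h'))
    where
    apart : ∀ {c y} → c ∈ pathColours R₁ true g g' → y ∈ pathColours R₂ (side g') h h' → mergeLast a S c ≢ a ↑ʳ y
    apart c∈ y∈ eq with clash eq
    ... | refl , refl = [ (λ last∉ → last∉ c∈) , (λ S∉ → S∉ y∈) ] avoid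
  ... | H-first S∉ = subst Unique (sym (colours-HG (path R₁ g g') (path R₂ h h')))
        (unique-map-++ (↑ʳ-injective a _ _) (mergeLast-injective a S) apart
           (path-rainbow R₂ (side g) h h') (path-rainbow R₁ true g g'))
    where
    apart : ∀ {y c} → y ∈ pathColours R₂ (side g) h h' → c ∈ pathColours R₁ true g g' → a ↑ʳ y ≢ mergeLast a S c
    apart y∈ _ eq with clash (sym eq)
    ... | _ , refl = S∉ y∈

  shared : RainbowSystem (G □ H) (a + k₂)
  shared = record
    { distance     = productDistance (distance R₁) (distance R₂)
    ; colouring    = λ _ → colouring⊗
    ; path         = path⊗
    ; path-length  = λ { (g , h) (g' , h') → length⊗ g g' h h' }
    ; path-rainbow = λ { _ (g , h) (g' , h') → rainbow⊗ g g' h h' }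
    }

module CycleArithmetic (m : ℕ) where

  n : ℕ
  n = suc m

  %-absorbˡ : ∀ x t → (x % n + t) % n ≡ (x + t) % n
  %-absorbˡ x t = begin
    (x % n + t) % n         ≡⟨ %-distribˡ-+ (x % n) t n ⟩
    (x % n % n + t % n) % n ≡⟨ cong (λ z → (z + t % n) % n) (m%n%n≡m%n x n) ⟩
    (x % n + t % n) % n     ≡⟨ %-distribˡ-+ x t n ⟨
    (x + t) % n             ∎
    where open ≡-Reasoning

  next : ℕ → ℕ
  next x = suc x % n

  next-cases : ∀ {x} → x < n → (suc x < n × next x ≡ suc x) ⊎ (x ≡ m × next x ≡ 0)
  next-cases {x} x<n with suc x <? n
  ... | yes sx<n = inj₁ (sx<n , m<n⇒m%n≡m sx<n)
  ... | no sx≮n = inj₂ (x≡m , trans (cong (λ z → suc z % n) x≡m) (n%n≡0 n))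
    where x≡m = ≤-antisym (s≤s⁻¹ x<n) (s≤s⁻¹ (≮⇒≥ sx≮n))

  fd : ℕ → ℕ → ℕ
  fd x y with x ≤? y
  ... | yes _ = y ∸ x
  ... | no _ = n ∸ x + y

  fd-≤ : ∀ {x y} → x ≤ y → fd x y ≡ y ∸ x
  fd-≤ {x} {y} x≤y with x ≤? y
  ... | yes _ = refl
  ... | no x≰y = ⊥-elim (x≰y x≤y)

  fd-> : ∀ {x y} → y < x → fd x y ≡ n ∸ x + y
  fd-> {x} {y} y<x with x ≤? y
  ... | yes x≤y = ⊥-elim (<⇒≱ y<x x≤y)
  ... | no _ = refl

  fd-self : ∀ x → fd x x ≡ 0
  fd-self x = trans (fd-≤ (≤-refl {x})) (n∸n≡0 x)

  fd-arrives : ∀ {x y} → x < n → y < n → (x + fd x y) % n ≡ y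
  fd-arrives {x} {y} x<n y<n with x ≤? y
  ... | yes x≤y = trans (cong (_% n) (m+[n∸m]≡n x≤y)) (m<n⇒m%n≡m y<n)
  ... | no _ = begin
    (x + (n ∸ x + y)) % n ≡⟨ cong (_% n) (+-assoc x (n ∸ x) y) ⟨
    (x + (n ∸ x) + y) % n ≡⟨ cong (λ z → (z + y) % n) (m+[n∸m]≡n (<⇒≤ x<n)) ⟩
    (n + y) % n           ≡⟨ %-remove-+ˡ y (∣-refl {n}) ⟩
    y % n                 ≡⟨ m<n⇒m%n≡m y<n ⟩
    y                     ∎
    where open ≡-Reasoning

  fd-full-turn : ∀ {x y} → x < y → y < n → fd x y + fd y x ≡ n
  fd-full-turn {x} {y} x<y y<n = begin
    fd x y + fd y x         ≡⟨ cong₂ _+_ (fd-≤ (<⇒≤ x<y)) (fd-> x<y) ⟩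
    (y ∸ x) + (n ∸ y + x)   ≡⟨ cong ((y ∸ x) +_) (+-comm (n ∸ y) x) ⟩
    (y ∸ x) + (x + (n ∸ y)) ≡⟨ +-assoc (y ∸ x) x (n ∸ y) ⟨
    (y ∸ x) + x + (n ∸ y)   ≡⟨ cong (_+ (n ∸ y)) (m∸n+n≡m (<⇒≤ x<y)) ⟩
    y + (n ∸ y)             ≡⟨ m+[n∸m]≡n (<⇒≤ y<n) ⟩
    n                       ∎
    where open ≡-Reasoning

  fd-round-trip : ∀ {x y} → x < n → y < n → fd x y + fd y x ≤ n
  fd-round-trip {x} {y} x<n y<n with <-cmp x y
  ... | tri< x<y _ _ = ≤-reflexive (fd-full-turn x<y y<n)
  ... | tri≈ _ refl _ = subst (_≤ n) (sym (cong₂ _+_ (fd-self x) (fd-self x))) z≤n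
  ... | tri> _ _ y<x = ≤-reflexive (trans (+-comm (fd x y) _) (fd-full-turn y<x x<n))

  fd-from-suc : ∀ {x y} → x < n → x ≢ y → fd x y ≡ suc (fd (suc x) y)
  fd-from-suc {x} {y} x<n x≢y with <-cmp y x
  ... | tri< y<x _ _ = trans (fd-> y<x) (trans (cong (_+ y) (∸-suc-split x<n)) (cong suc (sym (fd-> (m<n⇒m<1+n y<x)))))
  ... | tri≈ _ y≡x _ = ⊥-elim (x≢y (sym y≡x))
  ... | tri> _ _ x<y = trans (fd-≤ (<⇒≤ x<y)) (trans (∸-suc-split x<y) (cong suc (sym (fd-≤ x<y))))

  fd-from-last : ∀ {y} → y < m → fd m y ≡ suc (fd 0 y)
  fd-from-last {y} y<m = trans (fd-> y<m) (cong (_+ y) (m+n∸n≡m 1 m))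

  fd-from-next : ∀ {x y} → x < n → y < n → x ≢ y → fd x y ≡ suc (fd (next x) y)
  fd-from-next {x} {y} x<n y<n x≢y with next-cases x<n
  ... | inj₁ (_ , next≡suc) = trans (fd-from-suc x<n x≢y) (cong (λ z → suc (fd z y)) (sym next≡suc))
  ... | inj₂ (refl , next≡0) = trans (fd-from-last y<m) (cong (λ z → suc (fd z y)) (sym next≡0))
    where y<m = ≤∧≢⇒< (s≤s⁻¹ y<n) (λ y≡m → x≢y (sym y≡m))

  fd-to-suc : ∀ {x y} → y ≢ suc x → fd y (suc x) ≡ suc (fd y x)
  fd-to-suc {x} {y} y≢sx with y ≤? x
  ... | yes y≤x = trans (fd-≤ (m≤n⇒m≤1+n y≤x)) (+-∸-assoc 1 y≤x)
  ... | no y≰x = trans (fd-> sx<y) (+-suc (n ∸ y) x)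
    where
    x<y = ≰⇒> y≰x
    sx<y = ≤∧≢⇒< x<y (λ sx≡y → y≢sx (sym sx≡y))

  fd-to-zero : ∀ {y} → 0 < y → y < n → fd y 0 ≡ suc (fd y m)
  fd-to-zero {y} 0<y y<n = trans (fd-> 0<y) (trans (+-identityʳ _) (trans (+-∸-assoc 1 y≤m) (cong suc (sym (fd-≤ y≤m)))))
    where y≤m = s≤s⁻¹ y<n

  fd-to-next : ∀ {x y} → x < n → y < n → next x ≢ y → fd y (next x) ≡ suc (fd y x)
  fd-to-next {x} {y} x<n y<n next≢y with next-cases x<n
  ... | inj₁ (_ , next≡suc) = trans (cong (fd y) next≡suc) (fd-to-suc (λ y≡sx → next≢y (trans next≡suc (sym y≡sx))))
  ... | inj₂ (refl , next≡0) = trans (cong (fd y) next≡0) (fd-to-zero 0<y y<n)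
    where 0<y = n≢0⇒n>0 (λ y≡0 → next≢y (trans next≡0 (sym y≡0)))

  next-≢ : ∀ {x} → 1 ≤ m → x < n → x ≢ next x
  next-≢ {x} 1≤m x<n x≡next with next-cases x<n
  ... | inj₁ (_ , next≡suc) = <-irrefl (trans x≡next next≡suc) (n<1+n x)
  ... | inj₂ (refl , next≡0) = <⇒≢ 1≤m (sym (trans x≡next next≡0))

  fd-next : ∀ {x} → 1 ≤ m → x < n → fd x (next x) ≡ 1
  fd-next {x} 1≤m x<n = trans (fd-from-next x<n (m%n<n (suc x) n) (next-≢ 1≤m x<n)) (cong suc (fd-self (next x)))

  fd-source-step : ∀ {x y} → x < n → y < n → fd x y ≤ suc (fd (next x) y)
  fd-source-step {x} {y} x<n y<n with x ≟ y
  ... | yes refl = ≤-trans (≤-reflexive (fd-self x)) z≤n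
  ... | no x≢y = ≤-reflexive (fd-from-next x<n y<n x≢y)

  fd-target-step : ∀ {x y} → x < n → y < n → fd y (next x) ≤ suc (fd y x)
  fd-target-step {x} {y} x<n y<n with next x ≟ y
  ... | yes refl = ≤-trans (≤-reflexive (fd-self (next x))) z≤n
  ... | no next≢y = ≤-reflexive (fd-to-next x<n y<n next≢y)

  cd : ℕ → ℕ → ℕ
  cd x y = fd x y ⊓ fd y x

  cd-from-next : ∀ {x y} → 1 ≤ m → x < n → y < n → cd x y ≤ suc (cd (next x) y)
  cd-from-next {x} {y} 1≤m x<n y<n = ⊓-glb (≤-trans (m⊓n≤m _ _) (fd-source-step x<n y<n)) around
    where
    around : cd x y ≤ suc (fd y (next x))
    around with next x ≟ y
    ... | yes refl = ≤-trans (m⊓n≤m _ _) (≤-trans (≤-reflexive (fd-next 1≤m x<n)) (s≤s z≤n))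
    ... | no next≢y = begin
      cd x y              ≤⟨ m⊓n≤n _ _ ⟩
      fd y x              ≤⟨ n≤1+n _ ⟩
      suc (fd y x)        ≡⟨ fd-to-next x<n y<n next≢y ⟨
      fd y (next x)       ≤⟨ n≤1+n _ ⟩
      suc (fd y (next x)) ∎
      where open ≤-Reasoning

  cd-to-next : ∀ {x y} → 1 ≤ m → x < n → y < n → cd (next x) y ≤ suc (cd x y)
  cd-to-next {x} {y} 1≤m x<n y<n = ⊓-glb around (≤-trans (m⊓n≤n _ _) (fd-target-step x<n y<n))
    where
    around : cd (next x) y ≤ suc (fd x y)
    around with x ≟ y
    ... | yes refl = ≤-trans (m⊓n≤n _ _) (≤-trans (≤-reflexive (fd-next 1≤m x<n)) (s≤s z≤n))
    ... | no x≢y = begin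
      cd (next x) y       ≤⟨ m⊓n≤m _ _ ⟩
      fd (next x) y       ≤⟨ n≤1+n _ ⟩
      suc (fd (next x) y) ≡⟨ fd-from-next x<n y<n x≢y ⟨
      fd x y              ≤⟨ n≤1+n _ ⟩
      suc (fd x y)        ∎
      where open ≤-Reasoning

  -- The colours f e of the edges e = x, x+1, …, x+t−1 (mod n) met by walking
  -- t steps forward from x.
  arc : {A : Set} → (ℕ → A) → ℕ → ℕ → List A
  arc f x t = applyUpTo (λ s → f ((x + s) % n)) t

  arc-step : ∀ {A : Set} (f : ℕ → A) {x} t → x < n → arc f x (suc t) ≡ f x ∷ arc f (next x) t
  arc-step f {x} t x<n = cong₂ _∷_ (cong f (trans (cong (_% n) (+-identityʳ x)) (m<n⇒m%n≡m x<n)))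
    (applyUpTo-cong (λ {s} → cong f (sym (shift {s}))) t)
    where
    shift : ∀ {s} → (next x + s) % n ≡ (x + suc s) % n
    shift {s} = trans (%-absorbˡ (suc x) s) (cong (_% n) (sym (+-suc x s)))

-- A rainbow system on the cycle of length n = m + 1 ≥ 2 in which the edge
-- {e, e+1} (mod n) gets colour  edgeColour b e  under colouring b.  It only
-- needs that every arc covering at most half of the cycle is rainbow.  (For
-- n = 2 the single edge is seen from both ends, whence two-cycle.)
module CycleSystem (m : ℕ) (1≤m : 1 ≤ m) {k : ℕ} (edgeColour : Bool → ℕ → Fin k)
  (two-cycle : m ≡ 1 → ∀ b → edgeColour b 0 ≡ edgeColour b 1)
  (arc-rainbow : ∀ b x t → t + t ≤ suc m → Unique (CycleArithmetic.arc m (edgeColour b) x t)) where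

  open CycleArithmetic m

  succ : Fin n → Fin n
  succ i = fromℕ< (m%n<n (suc (toℕ i)) n)

  toℕ-succ : ∀ i → toℕ (succ i) ≡ next (toℕ i)
  toℕ-succ i = toℕ-fromℕ< _

  adjacent-succ : ∀ {u w} → Adj (Cycle n) u w → w ≡ succ u ⊎ u ≡ succ w
  adjacent-succ {u} {w} (inj₁ w≡next) = inj₁ (toℕ-injective (trans w≡next (sym (toℕ-succ u))))
  adjacent-succ {u} {w} (inj₂ u≡next) = inj₂ (toℕ-injective (trans u≡next (sym (toℕ-succ w))))

  advance : Fin n → ℕ → Fin n
  advance v zero = v
  advance v (suc t) = advance (succ v) t

  toℕ-advance : ∀ v t → toℕ (advance v t) ≡ (toℕ v + t) % n
  toℕ-advance v zero = sym (trans (cong (_% n) (+-identityʳ (toℕ v))) (m<n⇒m%n≡m (toℕ<n v)))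
  toℕ-advance v (suc t) = trans (toℕ-advance (succ v) t)
    (trans (cong (λ z → (z + t) % n) (toℕ-succ v))
      (trans (%-absorbˡ (suc (toℕ v)) t) (cong (_% n) (sym (+-suc (toℕ v) t)))))

  forward : ∀ v t → Walk (Cycle n) v (advance v t)
  forward v zero = []
  forward v (suc t) = inj₁ (toℕ-succ v) ∷ forward (succ v) t

  length-forward : ∀ v t → walkLength (forward v t) ≡ t
  length-forward v zero = refl
  length-forward v (suc t) = cong suc (length-forward (succ v) t)

  -- The edge {e, e+1} has colour  edgeColour b e ; only the wrap-around edge
  -- {m, 0} falls into the last case (non-edges are irrelevant).
  colourᶜ : Bool → Fin n → Fin n → Fin k
  colourᶜ b u v with toℕ v ≟ suc (toℕ u) | toℕ u ≟ suc (toℕ v)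
  ... | yes _ | _     = edgeColour b (toℕ u)
  ... | no _  | yes _ = edgeColour b (toℕ v)
  ... | no _  | no _  = edgeColour b m

  symmetricᶜ : ∀ b u v → colourᶜ b u v ≡ colourᶜ b v u
  symmetricᶜ b u v with toℕ v ≟ suc (toℕ u) | toℕ u ≟ suc (toℕ v)
  ... | yes v≡su | yes u≡sv = ⊥-elim (<-irrefl (trans u≡sv (cong suc v≡su)) (m<n⇒m<1+n (n<1+n _)))
  ... | yes _ | no _ = refl
  ... | no _  | yes _ = refl
  ... | no _  | no _ = refl

  colouringᶜ : Bool → EdgeColoring (Cycle n) k
  colouringᶜ b = record { colour = colourᶜ b ; symmetric = symmetricᶜ b }

  colour-succ : ∀ b u → colourᶜ b u (succ u) ≡ edgeColour b (toℕ u)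
  colour-succ b u with next-cases (toℕ<n u) | toℕ (succ u) ≟ suc (toℕ u) | toℕ u ≟ suc (toℕ (succ u))
  ... | _                     | yes _ | _ = refl
  ... | inj₁ (_ , next≡suc)   | no succ≢ | _ = ⊥-elim (succ≢ (trans (toℕ-succ u) next≡suc))
  ... | inj₂ (u≡m , next≡0)   | no _ | no _ = cong (edgeColour b) (sym u≡m)
  ... | inj₂ (u≡m , next≡0)   | no _ | yes u≡1+succ = begin
    edgeColour b (toℕ (succ u)) ≡⟨ cong (edgeColour b) succ≡0 ⟩
    edgeColour b 0              ≡⟨ two-cycle (trans (sym u≡m) u≡1) b ⟩
    edgeColour b 1              ≡⟨ cong (edgeColour b) u≡1 ⟨
    edgeColour b (toℕ u)        ∎
    where
    open ≡-Reasoning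
    succ≡0 = trans (toℕ-succ u) next≡0
    u≡1 = trans u≡1+succ (cong suc succ≡0)

  colours-forward : ∀ b v t → walkColours (colouringᶜ b) (forward v t) ≡ arc (edgeColour b) (toℕ v) t
  colours-forward b v zero = refl
  colours-forward b v (suc t) = begin
    colourᶜ b v (succ v) ∷ walkColours (colouringᶜ b) (forward (succ v) t)
      ≡⟨ cong₂ _∷_ (colour-succ b v) (colours-forward b (succ v) t) ⟩
    edgeColour b (toℕ v) ∷ arc (edgeColour b) (toℕ (succ v)) t
      ≡⟨ cong (λ z → edgeColour b (toℕ v) ∷ arc (edgeColour b) z t) (toℕ-succ v) ⟩
    edgeColour b (toℕ v) ∷ arc (edgeColour b) (next (toℕ v)) t
      ≡⟨ arc-step (edgeColour b) t (toℕ<n v) ⟨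
    arc (edgeColour b) (toℕ v) (suc t) ∎
    where open ≡-Reasoning

  fdᶜ : Fin n → Fin n → ℕ
  fdᶜ u v = fd (toℕ u) (toℕ v)

  cycleDistance : Distance (Cycle n)
  cycleDistance = record
    { decEq     = Fin._≟_
    ; loopless  = no-loop
    ; dist      = λ u v → cd (toℕ u) (toℕ v)
    ; dist-refl = λ v → cong₂ _⊓_ (fd-self (toℕ v)) (fd-self (toℕ v))
    ; dist-step = step
    }
    where
    no-loop : ∀ {u} → ¬ Adj (Cycle n) u u
    no-loop {u} (inj₁ u≡next) = next-≢ 1≤m (toℕ<n u) u≡next
    no-loop {u} (inj₂ u≡next) = next-≢ 1≤m (toℕ<n u) u≡next

    step : ∀ {u w} v → Adj (Cycle n) u w → cd (toℕ u) (toℕ v) ≤ suc (cd (toℕ w) (toℕ v))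
    step {u} {w} v e with adjacent-succ e
    ... | inj₁ refl = subst (λ z → cd (toℕ u) (toℕ v) ≤ suc (cd z (toℕ v))) (sym (toℕ-succ u))
                        (cd-from-next 1≤m (toℕ<n u) (toℕ<n v))
    ... | inj₂ refl = subst (λ z → cd z (toℕ v) ≤ suc (cd (toℕ w) (toℕ v))) (sym (toℕ-succ w))
                        (cd-to-next 1≤m (toℕ<n w) (toℕ<n v))

  open Reversal {Cycle n} swap

  toward : ∀ u v → Walk (Cycle n) u v
  toward u v = subst (Walk (Cycle n) u) arrives (forward u (fdᶜ u v))
    where
    arrives : advance u (fdᶜ u v) ≡ v
    arrives = toℕ-injective (trans (toℕ-advance u (fdᶜ u v)) (fd-arrives (toℕ<n u) (toℕ<n v)))

  length-toward : ∀ u v → walkLength (toward u v) ≡ fdᶜ u v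
  length-toward u v = trans (length-subst _ (forward u (fdᶜ u v))) (length-forward u (fdᶜ u v))

  colours-toward : ∀ b u v → walkColours (colouringᶜ b) (toward u v) ≡ arc (edgeColour b) (toℕ u) (fdᶜ u v)
  colours-toward b u v = trans (colours-subst (colouringᶜ b) _ (forward u (fdᶜ u v))) (colours-forward b u (fdᶜ u v))

  pathᶜ : ∀ u v → Walk (Cycle n) u v
  pathᶜ u v with fdᶜ u v ≤? fdᶜ v u
  ... | yes _ = toward u v
  ... | no _  = reverseʷ (toward v u)

  length-pathᶜ : ∀ u v → walkLength (pathᶜ u v) ≡ cd (toℕ u) (toℕ v)
  length-pathᶜ u v with fdᶜ u v ≤? fdᶜ v u
  ... | yes uv≤vu = trans (length-toward u v) (sym (m≤n⇒m⊓n≡m uv≤vu))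
  ... | no uv≰vu = trans (length-reverseʷ (toward v u))
                     (trans (length-toward v u) (sym (m≥n⇒m⊓n≡n (<⇒≤ (≰⇒> uv≰vu)))))

  record Arc {u v : Fin n} (p : Walk (Cycle n) u v) : Set where
    field
      start length : ℕ
      start<n      : start < n
      short        : length + length ≤ n
      colours↭     : ∀ b → walkColours (colouringᶜ b) p ↭ arc (edgeColour b) start length
      ends         : (start ≡ toℕ u × (start + length) % n ≡ toℕ v) ⊎ (start ≡ toℕ v × (start + length) % n ≡ toℕ u)

  arcOf : ∀ u v → Arc (pathᶜ u v)
  arcOf u v with fdᶜ u v ≤? fdᶜ v u
  ... | yes uv≤vu = record
    { start = toℕ u ; length = fdᶜ u v ; start<n = toℕ<n u
    ; short = ≤-trans (+-monoʳ-≤ (fdᶜ u v) uv≤vu) (fd-round-trip (toℕ<n u) (toℕ<n v))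
    ; colours↭ = λ b → ↭-reflexive (colours-toward b u v)
    ; ends = inj₁ (refl , fd-arrives (toℕ<n u) (toℕ<n v))
    }
  ... | no uv≰vu = record
    { start = toℕ v ; length = fdᶜ v u ; start<n = toℕ<n v
    ; short = ≤-trans (+-monoʳ-≤ (fdᶜ v u) (<⇒≤ (≰⇒> uv≰vu))) (fd-round-trip (toℕ<n v) (toℕ<n u))
    ; colours↭ = λ b → ↭-trans (↭-reflexive (trans (colours-reverseʷ (colouringᶜ b) (toward v u))
                                                  (cong reverse (colours-toward b v u))))
                               (↭-reverse _)
    ; ends = inj₂ (refl , fd-arrives (toℕ<n v) (toℕ<n u))
    }

  cycleSystem : RainbowSystem (Cycle n) k
  cycleSystem = record
    { distance     = cycleDistance
    ; colouring    = colouringᶜ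
    ; path         = pathᶜ
    ; path-length  = length-pathᶜ
    ; path-rainbow = λ b u v → let open Arc (arcOf u v) in
                       unique-↭ (↭-sym (colours↭ b)) (arc-rainbow b start length short)
    }

mod-two-cycle : ∀ b → b + suc b ≡ 1 → 0 mod suc b ≡ 1 mod suc b
mod-two-cycle zero _ = refl
mod-two-cycle (suc b) eq = ⊥-elim (0≢1+n (sym (suc-injective (trans (sym (+-suc (suc b) (suc b))) eq))))

-- The even cycle C_{2a}: colour edge e by e mod a.  Two edges of an arc of
-- at most a edges are fewer than a apart, so their residues differ.
module EvenCycle (b : ℕ) where

  a m : ℕ
  a = suc b
  m = b + suc b

  open CycleArithmetic m

  evenColour : Bool → ℕ → Fin a
  evenColour _ e = e mod a

  a∣n : a ∣ n
  a∣n = divides 2 (cong suc (cong (b +_) (sym (+-identityʳ a))))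

  arc-rainbow : ∀ β x t → t + t ≤ n → Unique (arc (evenColour β) x t)
  arc-rainbow β x t short = applyUpTo⁺₁ _ t distinct
    where
    distinct : ∀ {i j} → i < j → j < t → (x + i) % n mod a ≢ (x + j) % n mod a
    distinct {i} {j} i<j j<t same = <⇒≱ (≤-<-trans (m∸n≤m j i) (<-≤-trans j<t (halve (≤-trans short (n≤1+n n)))))
                                       (∣⇒≤ ⦃ >-nonZero (m<n⇒0<n∸m i<j) ⦄ a∣j∸i)
      where
      same-residue : (x + i) % a ≡ (x + j) % a
      same-residue = trans (sym (m∣n⇒o%n%m≡o%m a n (x + i) a∣n))
                       (trans (fromℕ<-injective _ _ _ _ same) (m∣n⇒o%n%m≡o%m a n (x + j) a∣n))
      a∣j∸i : a ∣ j ∸ i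
      a∣j∸i = subst (a ∣_) ([m+n]∸[m+o]≡n∸o x j i) (%-≡⇒∣∸ a same-residue (+-monoʳ-≤ x (<⇒≤ i<j)))

  1≤m : 1 ≤ m
  1≤m = subst (1 ≤_) (sym (+-suc b b)) (s≤s z≤n)

  evenSystem : RainbowSystem (Cycle (a + a)) a
  evenSystem = CycleSystem.cycleSystem m 1≤m evenColour (λ m≡1 _ → mod-two-cycle b m≡1) arc-rainbow

-- The odd cycle C_{2a+1} with c = a + 1 colours: the first colouring gives
-- edge e the colour e mod c, the second the colour of the edge e + c.  The
-- last colour a sits on edge a in the first colouring and on edge 2a in the
-- second; no short arc contains both, so a is free.  A short arc through
-- edge a joins {0,…,a} to {a+1,…,2a}, so the side "≤ a" separates a.
module OddCycle (b : ℕ) where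

  a c m : ℕ
  a = suc b
  c = suc a
  m = a + a

  open CycleArithmetic m

  n<c+c : n < c + c
  n<c+c = s≤s (+-monoʳ-< a (n<1+n a))

  oddColour : Bool → ℕ → Fin c
  oddColour true  e = e mod c
  oddColour false e = ((e + c) % n) mod c

  same-residue : ∀ {p q} → p < n → q ≤ p → p % c ≡ q % c → p ≡ q ⊎ p ≡ q + c
  same-residue {p} {q} p<n q≤p same with %-≡⇒∣∸ c (sym same) q≤p
  ... | divides zero p∸q≡0 = inj₁ (trans (sym (m∸n+n≡m q≤p)) (cong (_+ q) p∸q≡0))
  ... | divides (suc zero) p∸q≡c = inj₂ (trans (sym (m∸n+n≡m q≤p))
                                      (trans (cong (_+ q) (trans p∸q≡c (+-identityʳ c))) (+-comm c q)))
  ... | divides (suc (suc k)) p∸q≡ = ⊥-elim (<⇒≱ (<-trans (≤-<-trans (m∸n≤m p q) p<n) n<c+c)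
                                        (subst (c + c ≤_) (sym p∸q≡) (+-monoʳ-≤ c (m≤m+n c (k * c)))))

  below-a⇒below-n : ∀ {d} → d < a → d < n
  below-a⇒below-n d<a = <-trans d<a (≤-trans (n<1+n a) (s≤s (m≤m+n a a)))

  residue-shift : ∀ {p d} → p + d < n → 0 < d → d < c → (p + d) % c ≢ p % c
  residue-shift {p} {d} p+d<n 0<d d<c same with same-residue p+d<n (m≤m+n p d) same
  ... | inj₁ p+d≡p = <⇒≢ 0<d (sym (+-cancelˡ-≡ p d 0 (trans p+d≡p (sym (+-identityʳ p)))))
  ... | inj₂ p+d≡p+c = <⇒≢ d<c (+-cancelˡ-≡ p d c p+d≡p+c)

  residue-wrap : ∀ {p q d} → p < n → d < a → q + n ≡ p + d → q % c ≢ p % c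
  residue-wrap {p} {q} {d} p<n d<a wrap same with same-residue p<n (<⇒≤ q<p) (sym same)
    where
    q<p : q < p
    q<p = +-cancelʳ-< n q p (subst (_< p + n) (sym wrap) (+-monoʳ-< p (below-a⇒below-n d<a)))
  ... | inj₁ p≡q = <⇒≢ (below-a⇒below-n d<a) (sym (+-cancelˡ-≡ q n d (trans wrap (cong (_+ d) p≡q))))
  ... | inj₂ p≡q+c = <⇒≢ d<a (sym (+-cancelˡ-≡ c a d (+-cancelˡ-≡ q (c + a) (c + d)
          (trans wrap (trans (cong (_+ d) p≡q+c) (+-assoc q c d))))))

  step-changes-residue : ∀ {p d} → p < n → 0 < d → d < a → (p + d) % n % c ≢ p % c
  step-changes-residue {p} {d} p<n 0<d d<a
    with %-below-double (p + d) n (+-mono-< p<n (below-a⇒below-n d<a))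
  ... | inj₁ no-wrap = subst (λ z → z % c ≢ p % c) (sym no-wrap)
                         (residue-shift (subst (_< n) no-wrap (m%n<n (p + d) n)) 0<d (<-trans d<a (n<1+n a)))
  ... | inj₂ wrap = residue-wrap p<n d<a wrap

  -- Edges x+i and x+j of a short arc are 0 < j − i < a steps apart.
  arc-rainbow-first : ∀ x t → t + t ≤ n → Unique (arc (oddColour true) x t)
  arc-rainbow-first x t short = applyUpTo⁺₁ _ t distinct
    where
    distinct : ∀ {i j} → i < j → j < t → (x + i) % n mod c ≢ (x + j) % n mod c
    distinct {i} {j} i<j j<t same = step-changes-residue (m%n<n (x + i) n) (m<n⇒0<n∸m i<j) d<a
      (trans (cong (λ z → z % c) (sym ahead)) (sym (fromℕ<-injective _ _ _ _ same)))
      where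
      d<a : j ∸ i < a
      d<a = ≤-<-trans (m∸n≤m j i) (<-≤-trans j<t (halve short))
      ahead : (x + j) % n ≡ ((x + i) % n + (j ∸ i)) % n
      ahead = trans (cong (λ z → (x + z) % n) (sym (m+[n∸m]≡n (<⇒≤ i<j))))
                (trans (cong (_% n) (sym (+-assoc x i (j ∸ i)))) (sym (%-absorbˡ (x + i) (j ∸ i))))

  arc-second : ∀ x t → arc (oddColour false) x t ≡ arc (oddColour true) (x + c) t
  arc-second x t = applyUpTo-cong (λ {s} → cong (_mod c) (rotate s)) t
    where
    rotate : ∀ s → ((x + s) % n + c) % n ≡ (x + c + s) % n
    rotate s = trans (%-absorbˡ (x + s) c)
      (cong (_% n) (trans (+-assoc x s c) (trans (cong (x +_) (+-comm s c)) (sym (+-assoc x c s)))))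

  arc-rainbow : ∀ β x t → t + t ≤ n → Unique (arc (oddColour β) x t)
  arc-rainbow true  x t short = arc-rainbow-first x t short
  arc-rainbow false x t short = subst Unique (sym (arc-second x t)) (arc-rainbow-first (x + c) t short)

  -- n ≥ 3, so the two-cycle condition is vacuous.
  m≢1 : m ≢ 1
  m≢1 m≡1 = 0≢1+n (sym (suc-injective (trans (sym (+-suc a b)) m≡1)))

  module Odd = CycleSystem m (s≤s z≤n) oddColour (λ m≡1 → ⊥-elim (m≢1 m≡1)) arc-rainbow

  oddSystem : RainbowSystem (Cycle n) c
  oddSystem = Odd.cycleSystem

  last : Fin c
  last = fromℕ a

  last-residue : ∀ {e} → last ≡ e mod c → e % c ≡ a
  last-residue last≡ = trans (sym (toℕ-fromℕ< _)) (trans (cong toℕ (sym last≡)) (toℕ-fromℕ a))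

  last-edge : ∀ {e} → e < n → last ≡ e mod c → e ≡ a
  last-edge {e} e<n last≡ with %-below-double e c (<-trans e<n n<c+c)
  ... | inj₁ e%c≡e = trans (sym e%c≡e) (last-residue {e} last≡)
  ... | inj₂ wrapped = ⊥-elim (<-irrefl (sym (trans (cong (_+ c) (sym (last-residue {e} last≡))) wrapped))
                                        (subst (e <_) (+-comm c a) e<n))

  last-on-arc : ∀ {x t} → last ∈ arc (oddColour true) x t → ∃ λ s → s < t × (x + s) % n ≡ a
  last-on-arc {x} last∈ with ∈-applyUpTo⁻ _ last∈
  ... | s , s<t , last≡ = s , s<t , last-edge (m%n<n (x + s) n) last≡

  last-twice : ∀ {x s s' t} → t ≤ a → s < t → s' < t → (x + s) % n ≡ a → (x + c + s') % n ≡ a → ⊥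
  last-twice {x} {s} {s'} t≤a s<t s'<t hit hit' = <⇒≱ gap<n (∣⇒≤ ⦃ >-nonZero 0<gap ⦄ n∣gap)
    where
    s<c : s < c
    s<c = <-trans (<-≤-trans s<t t≤a) (n<1+n a)
    0<gap : 0 < c + s' ∸ s
    0<gap = m<n⇒0<n∸m (<-≤-trans s<c (m≤m+n c s'))
    gap<n : c + s' ∸ s < n
    gap<n = ≤-<-trans (m∸n≤m (c + s') s) (+-monoʳ-< c (<-≤-trans s'<t t≤a))
    n∣gap : n ∣ c + s' ∸ s
    n∣gap = subst (n ∣_) ([m+n]∸[m+o]≡n∸o x (c + s') s)
      (%-≡⇒∣∸ n (trans hit (sym (trans (cong (_% n) (sym (+-assoc x c s'))) hit')))
        (+-monoʳ-≤ x (≤-trans (<⇒≤ s<c) (m≤m+n c s'))))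

  open DecMembership (Fin._≟_ {n = c}) using (_∈?_)

  free : IsFree oddSystem last
  free u v with last ∈? RainbowSystem.pathColours oddSystem true u v
  ... | no last∉ = true , last∉
  ... | yes last∈ = false , λ last∈′ →
    let open Odd.Arc (Odd.arcOf u v)
        in-second = subst (last ∈_) (arc-second start length) (Any-resp-↭ (colours↭ false) last∈′)
        (s , s<t , hit) = last-on-arc {start} {length} (Any-resp-↭ (colours↭ true) last∈)
        (s' , s'<t , hit') = last-on-arc {start + c} {length} in-second
    in last-twice {start} (halve short) s<t s'<t hit hit'

  isLow : ℕ → Bool
  isLow x = does (x ≤? a)

  side : Fin n → Bool
  side v = isLow (toℕ v)

  crosses : ∀ {x s t} → x < n → s < t → t ≤ a → (x + s) % n ≡ a → isLow x ≡ true × isLow ((x + t) % n) ≡ false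
  crosses {x} {s} {t} x<n s<t t≤a hit with %-below-double (x + s) n (+-mono-< x<n (below-a⇒below-n s<a))
    where s<a = <-≤-trans s<t t≤a
  ... | inj₁ no-wrap = dec-true (x ≤? a) x≤a , dec-false (((x + t) % n) ≤? a) (<⇒≱ a<end)
    where
    x+s≡a = trans (sym no-wrap) hit
    x≤a = subst (x ≤_) x+s≡a (m≤m+n x s)
    a<end : a < (x + t) % n
    a<end = subst (a <_) (sym (m<n⇒m%n≡m (s≤s (+-mono-≤ x≤a t≤a)))) (subst (_< x + t) x+s≡a (+-monoʳ-< x s<t))
  ... | inj₂ wrap = ⊥-elim (<-irrefl (sym (trans (cong (_+ n) (sym hit)) wrap))
                                     (subst (x + s <_) (+-comm n a) (+-mono-< x<n (<-≤-trans s<t t≤a))))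

  separates : Separates oddSystem side
  separates u v last∈ = differ ends
    where
    open Odd.Arc (Odd.arcOf u v)
    hit = last-on-arc {start} {length} (Any-resp-↭ (colours↭ true) last∈)
    low×high = crosses start<n (proj₁ (proj₂ hit)) (halve short) (proj₂ (proj₂ hit))
    low = proj₁ low×high
    high = proj₂ low×high
    differ : (start ≡ toℕ u × (start + length) % n ≡ toℕ v) ⊎ (start ≡ toℕ v × (start + length) % n ≡ toℕ u) →
             side u ≢ side v
    differ (inj₁ (s≡u , e≡v)) = opposite (trans (cong isLow (sym s≡u)) low) (trans (cong isLow (sym e≡v)) high)
    differ (inj₂ (s≡v , e≡u)) = ≢-sym (opposite (trans (cong isLow (sym s≡v)) low) (trans (cong isLow (sym e≡u)) high))

halves : ∀ n → Σ ℕ λ h → n ≡ h + h ⊎ n ≡ suc (h + h)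
halves zero = 0 , inj₁ refl
halves (suc n) with halves n
... | h , inj₁ n≡2h = h , inj₂ (cong suc n≡2h)
... | h , inj₂ n≡2h+1 = suc h , inj₁ (cong suc (trans n≡2h+1 (sym (+-suc h h))))

data CycleCertificate (n : ℕ) : Set where
  even : ∀ a → n ≡ a + a → RainbowSystem (Cycle n) a → CycleCertificate n
  odd  : ∀ a → n ≡ suc (a + a) → (R : RainbowSystem (Cycle n) (suc a)) → IsFree R (fromℕ a) →
         (side : V (Cycle n) → Bool) → Separates R side → CycleCertificate n

cycleCertificate : ∀ n → 2 ≤ n → CycleCertificate n
cycleCertificate n 2≤n with halves n
cycleCertificate .0 () | zero , inj₁ refl
cycleCertificate .1 (s≤s ()) | zero , inj₂ refl
... | suc b , inj₁ refl = even (suc b) refl (EvenCycle.evenSystem b)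
... | suc b , inj₂ refl = odd (suc b) refl (OddCycle.oddSystem b) (OddCycle.free b) (OddCycle.side b) (OddCycle.separates b)

-- The induction invariant for a graph of weight s (the sum of the cycle
-- lengths): ⌈s/2⌉ colours suffice, and for odd s one of them is free.
data Balanced (G : Graph) (s : ℕ) : Set where
  even : ∀ h → s ≡ h + h → RainbowSystem G h → Balanced G s
  odd  : ∀ h → s ≡ suc (h + h) → (R : RainbowSystem G (suc h)) (S : Fin (suc h)) → IsFree R S → Balanced G s

oddᵏ : ∀ {G s k} h → k ≡ suc h → s ≡ suc (h + h) → (R : RainbowSystem G k) (S : Fin k) → IsFree R S → Balanced G s
oddᵏ h refl = odd h

balanced⇒src : ∀ {G s} → Balanced G s → src≤ G ⌈ s /2⌉
balanced⇒src (even h refl R) = h , ≤-reflexive (n≡⌈n+n/2⌉ h) , strongRainbow R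
balanced⇒src (odd h refl R _ _) = suc h , ≤-reflexive (cong suc (n≡⌊n+n/2⌋ h)) , strongRainbow R

cycle-balanced : ∀ {n} → CycleCertificate n → Balanced (Cycle n) n
cycle-balanced (even a n≡2a R) = even a n≡2a R
cycle-balanced (odd a n≡2a+1 R free _ _) = odd a n≡2a+1 R (fromℕ a) free

even+even : ∀ a h → (a + a) + (h + h) ≡ (a + h) + (a + h)
even+even = solve-∀

even+odd : ∀ a h → (a + a) + suc (h + h) ≡ suc ((a + h) + (a + h))
even+odd = solve-∀

odd+even : ∀ a h → suc (a + a) + (h + h) ≡ suc ((a + h) + (a + h))
odd+even = solve-∀

odd+odd : ∀ a h → suc (a + a) + suc (h + h) ≡ (a + suc h) + (a + suc h)
odd+odd = solve-∀

cycle□-balanced : ∀ {n H s} → CycleCertificate n → Balanced H s → Balanced (Cycle n □ H) (n + s)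
cycle□-balanced (even a refl R₁) (even h refl R₂) =
  even (a + h) (even+even a h) (Product.product R₁ R₂)
cycle□-balanced (even a refl R₁) (odd h refl R₂ S free) =
  oddᵏ (a + h) (+-suc a h) (even+odd a h) (Product.product R₁ R₂) (a ↑ʳ S) (Product.free-right R₁ R₂ S free)
cycle□-balanced (odd a refl R₁ free _ _) (even h refl R₂) =
  odd (a + h) (odd+even a h) (Product.product R₁ R₂) (fromℕ a ↑ˡ h) (Product.free-left R₁ R₂ (fromℕ a) free)
cycle□-balanced (odd a refl R₁ _ side separates) (odd h refl R₂ S free) =
  even (a + suc h) (odd+odd a h) (Shared.shared R₁ side separates R₂ S free)

cycleProduct-balanced : ∀ {r} (ns : Vec ℕ (suc r)) → All (2 ≤_) ns → Balanced (CycleProduct ns) (sum ns)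
cycleProduct-balanced (n ∷ []) (2≤n ∷ []) =
  subst (Balanced (Cycle n)) (sym (+-identityʳ n)) (cycle-balanced (cycleCertificate n 2≤n))
cycleProduct-balanced (n ∷ m ∷ ns) (2≤n ∷ 2≤m∷ns) =
  cycle□-balanced (cycleCertificate n 2≤n) (cycleProduct-balanced (m ∷ ns) 2≤m∷ns)

proposition3p1 : (r : ℕ) (ns : Vec ℕ (suc r)) → All (2 ≤_) ns →
    src≤ (CycleProduct ns) ⌈ sum ns /2⌉
proposition3p1 r ns 2≤ns = balanced⇒src (cycleProduct-balanced ns 2≤ns)
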